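{- For all positive integers $v_1,v_2,n_1,n_2,k_1,k_2,d$, \[f_{v_1v_2}(n_1n_2,k_1k_2,d)\ge d!\,f_{v_1}(n_1,k_1,d)\,f_{v_2}(n_2,k_2,d).\]
   Context: For a positive integer $v$, a $k\times d$ matrix with entries in an alphabet of size $v$ is shattered if every one of the $v^d$ words of length $d$ over the alphabet appears among its rows. $f_v(n,k,d)$ denotes the maximum, over all $k\times n$ matrices with entries from an alphabet of size $v$, of the number of shattered $k\times d$ submatrices (a $k\times d$ submatrix being determined by a set of $d$ columns). -}

module Defs where

open import Data.Nat using (ℕ; zero; suc; _+_; _⊔_)
open import Data.Fin using (Fin; _<_; _<?_)
import Data.Fin as Fin
open import Data.Fin.Properties using (any?; all?)
open import Data.List using (List; foldr; map; allFin)
open import Data.Nat.ListAction using (sum)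
open import Data.List.Relation.Unary.Linked using (Linked; linked?)
open import Data.Vec using (Vec; []; _∷_; lookup; toList)
import Data.Vec as Vec
open import Data.Vec.Properties using (≡-dec)
open import Data.Product using (Σ; ∃; ∃-syntax; _×_; _,_; proj₁; proj₂)
open import Relation.Nullary using (Dec; yes; no; ¬_)
open import Relation.Nullary.Decidable using (_×-dec_; map′)
open import Relation.Binary.PropositionalEquality using (_≡_; refl)
open import Relation.Unary using (Pred; Decidable)

Matrix : ℕ → ℕ → ℕ → Set
Matrix v k n = Vec (Vec (Fin v) n) k

-- A set of d columns of an n-column matrix, written as the strictly
-- increasing list of its column indices (c₁ < c₂ < … < c_d).
IsColumnSet : ∀ {n d} → Vec (Fin n) d → Set
IsColumnSet cols = Linked _<_ (toList cols)

subRow : ∀ {v k n d} → Matrix v k n → Vec (Fin n) d → Fin k → Vec (Fin v) d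
subRow M cols r = Vec.map (lookup (lookup M r)) cols

Shattered : ∀ {v k n d} → Matrix v k n → Vec (Fin n) d → Set
Shattered {v} {k} {n} {d} M cols =
  (w : Vec (Fin v) d) → ∃[ r ] (subRow M cols r ≡ w)

allWords? : ∀ {v} d {P : Vec (Fin v) d → Set} →
            ((w : Vec (Fin v) d) → Dec (P w)) → Dec ((w : Vec (Fin v) d) → P w)
allWords? zero P? with P? []
... | yes p = yes λ { [] → p }
... | no ¬p = no λ h → ¬p (h [])
allWords? (suc d) {P} P? =
  map′ (λ h → λ { (a ∷ w) → h a w }) (λ h a w → h (a ∷ w))
       (all? (λ a → allWords? d (λ w → P? (a ∷ w))))

shattered? : ∀ {v k n d} (M : Matrix v k n) (cols : Vec (Fin n) d) →
             Dec (Shattered M cols)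
shattered? {v} {k} {n} {d} M cols =
  allWords? d (λ w → any? (λ r → ≡-dec Fin._≟_ (subRow M cols r) w))

columnSet? : ∀ {n d} (cols : Vec (Fin n) d) → Dec (IsColumnSet cols)
columnSet? cols = linked? _<?_ (toList cols)

countVec : ∀ {n} d {P : Vec (Fin n) d → Set} →
           ((c : Vec (Fin n) d) → Dec (P c)) → ℕ
countVec zero P? with P? []
... | yes _ = 1
... | no _ = 0
countVec {n} (suc d) P? = sum (map (λ a → countVec d (λ c → P? (a ∷ c))) (allFin n))

numShattered : ∀ {v k n} → Matrix v k n → (d : ℕ) → ℕ
numShattered M d = countVec d (λ cols → columnSet? cols ×-dec shattered? M cols)

-- Maximum of g over all vectors in Vec (Fin v) n (0 if there are none).
maxVec : ∀ {v} n → (Vec (Fin v) n → ℕ) → ℕ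
maxVec zero g = g []
maxVec {v} (suc n) g = foldr _⊔_ 0 (map (λ a → maxVec n (λ w → g (a ∷ w))) (allFin v))

maxMatrix : ∀ {v} k n → (Matrix v k n → ℕ) → ℕ
maxMatrix zero n g = g []
maxMatrix (suc k) n g = maxVec n (λ row → maxMatrix k n (λ rest → g (row ∷ rest)))

f : (v n k d : ℕ) → ℕ
f v n k d = maxMatrix {v} k n (λ M → numShattered M d)

{-# OPTIONS --safe #-}

-- Take maximising matrices M₁, M₂ and their product M₁ ⊗ M₂, whose entry in row (r₁, r₂) and
-- column (c₁, c₂) is the pair (M₁ r₁ c₁, M₂ r₂ c₂); pairs of indices and of letters are encoded
-- by Fin.combine, which orders pairs lexicographically. For a shattered column set
-- a₁ < … < a_d of M₁, a shattered column set s₁ < … < s_d of M₂ and a permutation σ of d, the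
-- columns (a_i, s_σ(i)) are again increasing, and they shatter M₁ ⊗ M₂: a word of pairs splits
-- into a word for M₁ on a and, once σ is undone, a word for M₂ on s. Distinct triples (a, σ, s)
-- give distinct column sets, because the increasing s is determined by the set of second
-- coordinates and then σ by s.

module Submission where

open import Defs
open import Data.Nat as ℕ using (ℕ; zero; suc; _+_; _*_; _≤_; _⊔_; z≤n; s≤s; _!; NonZero)
open import Data.Nat.Properties
  using (≤-refl; ≤-trans; ≤-reflexive; m≤m⊔n; m≤n⇒m≤o⊔n; ⊔-sel; *-comm; *-assoc; *-mono-≤; *-monoʳ-≤;
         module ≤-Reasoning)
open import Data.Nat.ListAction using (sum)
open import Data.Fin as Fin using (Fin; _<_; _≟_; combine; remQuot; punchIn; punchOut)
open import Data.Fin.Properties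
  using (combine-injective; combine-surjective; combine-monoˡ-<; remQuot-combine;
         punchIn-injective; punchInᵢ≢i; punchIn-punchOut; <-trans; <-asym; <⇒≢)
open import Data.List using (List; []; _∷_; [_]; _++_; length; map; filter; foldr; allFin;
                             cartesianProduct; cartesianProductWith)
open import Data.List.Properties as List
  using (length-++; length-map; length-tabulate; filter-++; filter-notAll)
open import Data.List.Relation.Unary.Any using (here; there)
import Data.List.Relation.Unary.Any as Any
open import Data.List.Relation.Unary.All using (All; [])
import Data.List.Relation.Unary.All as All
import Data.List.Relation.Unary.All.Properties as All
open import Data.List.Relation.Unary.Linked using ([]; [-]; _∷_)
import Data.List.Relation.Unary.Linked as Linked
open import Data.List.Relation.Unary.AllPairs using ([]; _∷_)
open import Data.List.Relation.Unary.Unique.Propositional using (Unique)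
open import Data.List.Relation.Unary.Unique.Propositional.Properties
  using (filter⁺; allFin⁺; cartesianProduct⁺; cartesianProductWith⁺)
open import Data.List.Relation.Binary.Subset.Propositional using (_⊆_)
open import Data.List.Membership.Propositional using (_∈_)
open import Data.List.Membership.Propositional.Properties
  using (∈-map⁺; ∈-map⁻; ∈-allFin; ∈-filter⁺; ∈-filter⁻; foldr-selective;
         ∈-cartesianProduct⁻; ∈-cartesianProductWith⁺; ∈-cartesianProductWith⁻)
open import Data.Vec as Vec using (Vec; []; _∷_; lookup; tabulate; zipWith)
open import Data.Vec.Properties using (∷-injective; lookup-map; lookup∘tabulate; map-∘; map-cong; ≡-dec)
open import Data.Vec.Relation.Binary.Pointwise.Extensional using (ext; Pointwise-≡⇒≡)
open import Data.Product using (∃-syntax; Σ-syntax; ∃₂; _×_; _,_; proj₁; proj₂; uncurry)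
open import Data.Sum using (inj₁; inj₂)
open import Data.Empty using (⊥-elim)
open import Function using (_∘_)
open import Function.Definitions using (Injective; StrictlySurjective)
open import Relation.Nullary using (yes; no; ¬?)
open import Relation.Nullary.Decidable using (_×-dec_)
open import Relation.Unary using (Decidable)
open import Relation.Binary using (DecidableEquality)
open import Relation.Binary.PropositionalEquality
  using (_≡_; refl; sym; trans; cong; cong₂; subst; module ≡-Reasoning)

-- Counting and maximising over finite enumerations

length-cartesianProductWith : ∀ {A B C : Set} (g : A → B → C) (xs : List A) (ys : List B) →
  length (cartesianProductWith g xs ys) ≡ length xs * length ys
length-cartesianProductWith g []       ys = refl
length-cartesianProductWith g (x ∷ xs) ys = begin
  length (map (g x) ys ++ cartesianProductWith g xs ys)
    ≡⟨ length-++ (map (g x) ys) ⟩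
  length (map (g x) ys) + length (cartesianProductWith g xs ys)
    ≡⟨ cong₂ _+_ (length-map (g x) ys) (length-cartesianProductWith g xs ys) ⟩
  length ys + length xs * length ys ∎
  where open ≡-Reasoning

length-filter-map : ∀ {A B : Set} {P : B → Set} (P? : Decidable P) (g : A → B) (xs : List A) →
  length (filter P? (map g xs)) ≡ length (filter (P? ∘ g) xs)
length-filter-map P? g []       = refl
length-filter-map P? g (x ∷ xs) with P? (g x)
... | yes _ = cong suc (length-filter-map P? g xs)
... | no  _ = length-filter-map P? g xs

length-filter-cartesianProductWith : ∀ {A B C : Set} {P : C → Set} (P? : Decidable P)
  (g : A → B → C) (xs : List A) (ys : List B) →
  length (filter P? (cartesianProductWith g xs ys)) ≡ sum (map (λ x → length (filter (P? ∘ g x) ys)) xs)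
length-filter-cartesianProductWith P? g []       ys = refl
length-filter-cartesianProductWith P? g (x ∷ xs) ys = begin
  length (filter P? (map (g x) ys ++ cartesianProductWith g xs ys))
    ≡⟨ cong length (filter-++ P? (map (g x) ys) _) ⟩
  length (filter P? (map (g x) ys) ++ filter P? (cartesianProductWith g xs ys))
    ≡⟨ length-++ (filter P? (map (g x) ys)) ⟩
  length (filter P? (map (g x) ys)) + length (filter P? (cartesianProductWith g xs ys))
    ≡⟨ cong₂ _+_ (length-filter-map P? (g x) ys) (length-filter-cartesianProductWith P? g xs ys) ⟩
  length (filter (P? ∘ g x) ys) + sum (map (λ x → length (filter (P? ∘ g x) ys)) xs) ∎
  where open ≡-Reasoning

unique-⊆⇒length≤ : ∀ {A : Set} → DecidableEquality A → {xs ys : List A} →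
  Unique xs → xs ⊆ ys → length xs ≤ length ys
unique-⊆⇒length≤ _≟_ {[]}     _            _     = z≤n
unique-⊆⇒length≤ _≟_ {x ∷ xs} {ys} (x∉xs ∷ xs!) xs⊆ys =
  ≤-trans (s≤s (unique-⊆⇒length≤ _≟_ xs! xs⊆ys∖x)) ∣ys∖x∣<∣ys∣
  where
  ys∖x = filter (¬? ∘ (x ≟_)) ys
  xs⊆ys∖x : xs ⊆ ys∖x
  xs⊆ys∖x y∈xs = ∈-filter⁺ (¬? ∘ (x ≟_)) (xs⊆ys (there y∈xs)) (All.lookup x∉xs y∈xs)
  ∣ys∖x∣<∣ys∣ : length ys∖x ℕ.< length ys
  ∣ys∖x∣<∣ys∣ = filter-notAll (¬? ∘ (x ≟_)) ys (Any.map (λ x≡y x≢y → x≢y x≡y) (xs⊆ys (here refl)))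

map⁺-injectiveOn : ∀ {A B : Set} (g : A → B) {xs : List A} →
  (∀ {x y} → x ∈ xs → y ∈ xs → g x ≡ g y → x ≡ y) → Unique xs → Unique (map g xs)
map⁺-injectiveOn g inj []           = []
map⁺-injectiveOn g inj (x∉xs ∷ xs!) =
  All.map⁺ (All.tabulate λ y∈xs gx≡gy → All.lookup x∉xs y∈xs (inj (here refl) (there y∈xs) gx≡gy))
  ∷ map⁺-injectiveOn g (λ x∈ y∈ → inj (there x∈) (there y∈)) xs!

≤-foldr-⊔ : ∀ {m ms} → m ∈ ms → m ≤ foldr _⊔_ 0 ms
≤-foldr-⊔ {ms = m ∷ _}  (here refl) = m≤m⊔n m _
≤-foldr-⊔ {ms = m′ ∷ _} (there m∈)  = m≤n⇒m≤o⊔n m′ (≤-foldr-⊔ m∈)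

foldr-⊔-attained : ∀ {A : Set} (h : A → ℕ) → A → (xs : List A) → ∃[ a ] foldr _⊔_ 0 (map h xs) ≤ h a
foldr-⊔-attained h a₀ xs with foldr-selective ⊔-sel 0 (map h xs)
... | inj₁ max≡0 = a₀ , ≤-trans (≤-reflexive max≡0) z≤n
... | inj₂ max∈  with a , _ , max≡ha ← ∈-map⁻ h max∈ = a , ≤-reflexive max≡ha

allVecs : ∀ n d → List (Vec (Fin n) d)
allVecs n zero    = [ [] ]
allVecs n (suc d) = cartesianProductWith _∷_ (allFin n) (allVecs n d)

∈-allVecs : ∀ {n d} (w : Vec (Fin n) d) → w ∈ allVecs n d
∈-allVecs []      = here refl
∈-allVecs (a ∷ w) = ∈-cartesianProductWith⁺ _∷_ (∈-allFin a) (∈-allVecs w)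

allVecs-unique : ∀ n d → Unique (allVecs n d)
allVecs-unique n zero    = [] ∷ []
allVecs-unique n (suc d) = cartesianProductWith⁺ _∷_ ∷-injective (allFin⁺ n) (allVecs-unique n d)

countVec≡length-filter : ∀ {n} d {P : Vec (Fin n) d → Set} (P? : Decidable P) →
  countVec d P? ≡ length (filter P? (allVecs n d))
countVec≡length-filter zero P? with P? []
... | yes _ = refl
... | no  _ = refl
countVec≡length-filter {n} (suc d) P? = begin
  sum (map (λ a → countVec d (P? ∘ (a ∷_))) (allFin n))
    ≡⟨ cong sum (List.map-cong (λ a → countVec≡length-filter d (P? ∘ (a ∷_))) (allFin n)) ⟩
  sum (map (λ a → length (filter (P? ∘ (a ∷_)) (allVecs n d))) (allFin n))
    ≡⟨ length-filter-cartesianProductWith P? _∷_ (allFin n) (allVecs n d) ⟨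
  length (filter P? (allVecs n (suc d))) ∎
  where open ≡-Reasoning

length≤countVec : ∀ {n} d {P : Vec (Fin n) d → Set} (P? : Decidable P) {ws : List (Vec (Fin n) d)} →
  Unique ws → All P ws → length ws ≤ countVec d P?
length≤countVec {n} d P? {ws} ws! Pws = begin
  length ws                          ≤⟨ unique-⊆⇒length≤ (≡-dec _≟_) ws! ws⊆ ⟩
  length (filter P? (allVecs n d))   ≡⟨ countVec≡length-filter d P? ⟨
  countVec d P?                      ∎
  where
  open ≤-Reasoning
  ws⊆ : ws ⊆ filter P? (allVecs n d)
  ws⊆ w∈ws = ∈-filter⁺ P? (∈-allVecs _) (All.lookup Pws w∈ws)

≤-maxVec : ∀ {v} n (g : Vec (Fin v) n → ℕ) w → g w ≤ maxVec n g
≤-maxVec zero    g []      = ≤-refl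
≤-maxVec (suc n) g (a ∷ w) = ≤-trans (≤-maxVec n (g ∘ (a ∷_)) w)
  (≤-foldr-⊔ (∈-map⁺ (λ a → maxVec n (g ∘ (a ∷_))) (∈-allFin a)))

maxVec-attained : ∀ {v} n (g : Vec (Fin (suc v)) n → ℕ) → ∃[ w ] maxVec n g ≤ g w
maxVec-attained zero    g = [] , ≤-refl
maxVec-attained (suc n) g =
  let a , max≤  = foldr-⊔-attained (λ a → maxVec n (g ∘ (a ∷_))) Fin.zero (allFin _)
      w , max≤′ = maxVec-attained n (g ∘ (a ∷_))
  in  a ∷ w , ≤-trans max≤ max≤′

≤-maxMatrix : ∀ {v} k n (g : Matrix v k n → ℕ) M → g M ≤ maxMatrix k n g
≤-maxMatrix zero    n g []      = ≤-refl
≤-maxMatrix (suc k) n g (r ∷ M) = ≤-trans (≤-maxMatrix k n (g ∘ (r ∷_)) M)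
  (≤-maxVec n (λ r → maxMatrix k n (g ∘ (r ∷_))) r)

maxMatrix-attained : ∀ {v} k n (g : Matrix (suc v) k n → ℕ) → ∃[ M ] maxMatrix k n g ≤ g M
maxMatrix-attained zero    n g = [] , ≤-refl
maxMatrix-attained (suc k) n g =
  let r , max≤  = maxVec-attained n (λ r → maxMatrix k n (g ∘ (r ∷_)))
      M , max≤′ = maxMatrix-attained k n (g ∘ (r ∷_))
  in  r ∷ M , ≤-trans max≤ max≤′

-- Permutations

Vec-map-injective : ∀ {A B : Set} {g : A → B} {n} →
  Injective _≡_ _≡_ g → Injective _≡_ _≡_ (Vec.map {n = n} g)
Vec-map-injective g-inj {[]}    {[]}    _  = refl
Vec-map-injective g-inj {x ∷ xs} {y ∷ ys} eq =
  let gx≡gy , gxs≡gys = ∷-injective eq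
  in  cong₂ _∷_ (g-inj gx≡gy) (Vec-map-injective g-inj gxs≡gys)

IsPermutation : ∀ {d} → Vec (Fin d) d → Set
IsPermutation σ = StrictlySurjective _≡_ (lookup σ) × Injective _≡_ _≡_ (lookup σ)

extend : ∀ {d} → Fin (suc d) → Vec (Fin d) d → Vec (Fin (suc d)) (suc d)
extend i σ = i ∷ Vec.map (punchIn i) σ

extend-injective : ∀ {d} {i j : Fin (suc d)} {σ τ : Vec (Fin d) d} → extend i σ ≡ extend j τ → i ≡ j × σ ≡ τ
extend-injective {i = i} eq with ∷-injective eq
... | refl , σ≡τ = refl , Vec-map-injective (punchIn-injective i _ _) σ≡τ

extend-isPermutation : ∀ {d} (i : Fin (suc d)) {σ : Vec (Fin d) d} →
  IsPermutation σ → IsPermutation (extend i σ)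
extend-isPermutation i {σ} (σ-surj , σ-inj) = surj , inj
  where
  lookup-extend : ∀ j → lookup (extend i σ) (Fin.suc j) ≡ punchIn i (lookup σ j)
  lookup-extend j = lookup-map j (punchIn i) σ

  surj : StrictlySurjective _≡_ (lookup (extend i σ))
  surj j with i ≟ j
  ... | yes refl = Fin.zero , refl
  ... | no  i≢j  with σ-surj (punchOut i≢j)
  ... | k , σk≡j′ =
    Fin.suc k , trans (lookup-extend k) (trans (cong (punchIn i) σk≡j′) (punchIn-punchOut i≢j))

  inj : Injective _≡_ _≡_ (lookup (extend i σ))
  inj {Fin.zero}  {Fin.zero}  _  = refl
  inj {Fin.zero}  {Fin.suc b} eq = ⊥-elim (punchInᵢ≢i i (lookup σ b) (sym (trans eq (lookup-extend b))))
  inj {Fin.suc a} {Fin.zero}  eq = ⊥-elim (punchInᵢ≢i i (lookup σ a) (trans (sym (lookup-extend a)) eq))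
  inj {Fin.suc a} {Fin.suc b} eq =
    cong Fin.suc (σ-inj (punchIn-injective i _ _
      (trans (sym (lookup-extend a)) (trans eq (lookup-extend b)))))

permutations : ∀ d → List (Vec (Fin d) d)
permutations zero    = [ [] ]
permutations (suc d) = cartesianProductWith extend (allFin (suc d)) (permutations d)

length-permutations : ∀ d → length (permutations d) ≡ d !
length-permutations zero    = refl
length-permutations (suc d) = begin
  length (cartesianProductWith extend (allFin (suc d)) (permutations d))
    ≡⟨ length-cartesianProductWith extend (allFin (suc d)) (permutations d) ⟩
  length (allFin (suc d)) * length (permutations d)
    ≡⟨ cong₂ _*_ (length-tabulate {n = suc d} (λ i → i)) (length-permutations d) ⟩
  suc d * d ! ∎
  where open ≡-Reasoning

permutations-unique : ∀ d → Unique (permutations d)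
permutations-unique zero    = [] ∷ []
permutations-unique (suc d) =
  cartesianProductWith⁺ extend extend-injective (allFin⁺ (suc d)) (permutations-unique d)

∈-permutations⇒isPermutation : ∀ d {σ} → σ ∈ permutations d → IsPermutation σ
∈-permutations⇒isPermutation zero    {[]} _ = (λ ()) , λ {}
∈-permutations⇒isPermutation (suc d) σ∈
  with i , τ , _ , τ∈ , refl ← ∈-cartesianProductWith⁻ extend (allFin (suc d)) (permutations d) σ∈
  = extend-isPermutation i (∈-permutations⇒isPermutation d τ∈)

-- Column sets and their rearrangements

head<lookup : ∀ {n d} {c : Fin n} {cs : Vec (Fin n) d} → IsColumnSet (c ∷ cs) → ∀ i → c < lookup cs i
head<lookup {cs = _ ∷ _} (c<c′ ∷ _)  Fin.zero    = c<c′
head<lookup {cs = _ ∷ _} (c<c′ ∷ cs↑) (Fin.suc i) = <-trans c<c′ (head<lookup cs↑ i)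

isColumnSet⇒lookup-injective : ∀ {n d} {cs : Vec (Fin n) d} → IsColumnSet cs → Injective _≡_ _≡_ (lookup cs)
isColumnSet⇒lookup-injective {cs = _ ∷ _} cs↑ {Fin.zero}  {Fin.zero}  _  = refl
isColumnSet⇒lookup-injective {cs = _ ∷ _} cs↑ {Fin.zero}  {Fin.suc j} eq =
  ⊥-elim (<⇒≢ (head<lookup cs↑ j) eq)
isColumnSet⇒lookup-injective {cs = _ ∷ _} cs↑ {Fin.suc i} {Fin.zero}  eq =
  ⊥-elim (<⇒≢ (head<lookup cs↑ i) (sym eq))
isColumnSet⇒lookup-injective {cs = _ ∷ _} cs↑ {Fin.suc i} {Fin.suc j} eq =
  cong Fin.suc (isColumnSet⇒lookup-injective (Linked.tail cs↑) eq)

isColumnSet-unique : ∀ {n d} {cs cs′ : Vec (Fin n) d} → IsColumnSet cs → IsColumnSet cs′ →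
  (∀ i → ∃[ j ] lookup cs i ≡ lookup cs′ j) → (∀ j → ∃[ i ] lookup cs′ j ≡ lookup cs i) → cs ≡ cs′
isColumnSet-unique {cs = []}     {[]}     _   _    _     _     = refl
isColumnSet-unique {cs = c ∷ cs} {c′ ∷ cs′} cs↑ cs′↑ cs⊆cs′ cs′⊆cs =
  cong₂ _∷_ c≡c′ (isColumnSet-unique (Linked.tail cs↑) (Linked.tail cs′↑) tail⊆ tail⊇)
  where
  c≡c′ : c ≡ c′
  c≡c′ with cs⊆cs′ Fin.zero | cs′⊆cs Fin.zero
  ... | Fin.zero  , c≡c′ | _                   = c≡c′
  ... | Fin.suc _ , _    | Fin.zero  , c′≡c    = sym c′≡c
  ... | Fin.suc j , c≡   | Fin.suc i , c′≡ =
    ⊥-elim (<-asym (subst (c <_) (sym c′≡) (head<lookup cs↑ i))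
                   (subst (c′ <_) (sym c≡) (head<lookup cs′↑ j)))
  tail⊆ : ∀ i → ∃[ j ] lookup cs i ≡ lookup cs′ j
  tail⊆ i with cs⊆cs′ (Fin.suc i)
  ... | Fin.zero  , eq = ⊥-elim (<⇒≢ (head<lookup cs↑ i) (trans c≡c′ (sym eq)))
  ... | Fin.suc j , eq = j , eq
  tail⊇ : ∀ j → ∃[ i ] lookup cs′ j ≡ lookup cs i
  tail⊇ j with cs′⊆cs (Fin.suc j)
  ... | Fin.zero  , eq = ⊥-elim (<⇒≢ (head<lookup cs′↑ j) (trans (sym c≡c′) (sym eq)))
  ... | Fin.suc i , eq = i , eq

rearrange : ∀ {A : Set} {d e} → Vec (Fin d) e → Vec A d → Vec A e
rearrange σ w = Vec.map (lookup w) σ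

rearrange-surjective : ∀ {A : Set} {d} {σ : Vec (Fin d) d} → IsPermutation σ →
  ∀ (w : Vec A d) → ∃[ w′ ] rearrange σ w′ ≡ w
rearrange-surjective {σ = σ} (σ-surj , σ-inj) w = w′ , Pointwise-≡⇒≡ (ext pointwise)
  where
  w′ = tabulate (lookup w ∘ proj₁ ∘ σ-surj)
  pointwise : ∀ i → lookup (rearrange σ w′) i ≡ lookup w i
  pointwise i = begin
    lookup (rearrange σ w′) i                  ≡⟨ lookup-map i (lookup w′) σ ⟩
    lookup w′ (lookup σ i)                     ≡⟨ lookup∘tabulate _ (lookup σ i) ⟩
    lookup w (proj₁ (σ-surj (lookup σ i)))     ≡⟨ cong (lookup w) (σ-inj (proj₂ (σ-surj (lookup σ i)))) ⟩
    lookup w i                                 ∎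
    where open ≡-Reasoning

subRow-rearrange : ∀ {v k n d e} (M : Matrix v k n) (σ : Vec (Fin d) e) (cols : Vec (Fin n) d) r →
  subRow M (rearrange σ cols) r ≡ rearrange σ (subRow M cols r)
subRow-rearrange M σ cols r = begin
  Vec.map (lookup (lookup M r)) (Vec.map (lookup cols) σ)   ≡⟨ map-∘ (lookup (lookup M r)) (lookup cols) σ ⟨
  Vec.map (lookup (lookup M r) ∘ lookup cols) σ             ≡⟨ map-cong (λ i → sym (lookup-map i _ cols)) σ ⟩
  Vec.map (lookup (subRow M cols r)) σ                      ∎
  where open ≡-Reasoning

shattered-rearrange : ∀ {v k n d} (M : Matrix v k n) {σ : Vec (Fin d) d} {cols : Vec (Fin n) d} →
  IsPermutation σ → Shattered M cols → Shattered M (rearrange σ cols)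
shattered-rearrange M {σ} {cols} σ-perm cols-shattered w
  with w′ , refl ← rearrange-surjective {σ = σ} σ-perm w
  with r , refl ← cols-shattered w′
  = r , subRow-rearrange M σ cols r

rearrange-injectiveOn : ∀ {n d} {σ σ′ : Vec (Fin d) d} {cs cs′ : Vec (Fin n) d} →
  IsPermutation σ → IsPermutation σ′ → IsColumnSet cs → IsColumnSet cs′ →
  rearrange σ cs ≡ rearrange σ′ cs′ → σ ≡ σ′ × cs ≡ cs′
rearrange-injectiveOn {σ = σ} {σ′} {cs} {cs′} (σ-surj , _) (σ′-surj , _) cs↑ cs′↑ eq
  = σ≡σ′ , cs≡cs′
  where
  cs∘σ≗cs′∘σ′ : ∀ i → lookup cs (lookup σ i) ≡ lookup cs′ (lookup σ′ i)
  cs∘σ≗cs′∘σ′ i = trans (sym (lookup-map i (lookup cs) σ))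
                        (trans (cong (λ w → lookup w i) eq) (lookup-map i (lookup cs′) σ′))
  cs⊆cs′ : ∀ j → ∃[ j′ ] lookup cs j ≡ lookup cs′ j′
  cs⊆cs′ j with i , refl ← σ-surj j = lookup σ′ i , cs∘σ≗cs′∘σ′ i
  cs′⊆cs : ∀ j → ∃[ j′ ] lookup cs′ j ≡ lookup cs j′
  cs′⊆cs j with i , refl ← σ′-surj j = lookup σ i , sym (cs∘σ≗cs′∘σ′ i)
  cs≡cs′ : cs ≡ cs′
  cs≡cs′ = isColumnSet-unique cs↑ cs′↑ cs⊆cs′ cs′⊆cs
  σ≡σ′ : σ ≡ σ′
  σ≡σ′ = Pointwise-≡⇒≡ (ext λ i → isColumnSet⇒lookup-injective cs↑
    (trans (cs∘σ≗cs′∘σ′ i) (cong (λ w → lookup w (lookup σ′ i)) (sym cs≡cs′))))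

-- The product matrix

zipWith-combine-injective : ∀ {n₁ n₂ d} {a a′ : Vec (Fin n₁) d} {t t′ : Vec (Fin n₂) d} →
  zipWith combine a t ≡ zipWith combine a′ t′ → a ≡ a′ × t ≡ t′
zipWith-combine-injective {a = []}    {[]}      {[]}    {[]}      _  = refl , refl
zipWith-combine-injective {a = x ∷ a} {x′ ∷ a′} {y ∷ t} {y′ ∷ t′} eq
  with head≡ , tail≡ ← ∷-injective eq
  with refl , refl ← combine-injective x y x′ y′ head≡
  with refl , refl ← zipWith-combine-injective tail≡
  = refl , refl

zipWith-combine-surjective : ∀ {m n d} (w : Vec (Fin (m * n)) d) →
  ∃₂ λ (x : Vec (Fin m) d) (y : Vec (Fin n) d) → zipWith combine x y ≡ w
zipWith-combine-surjective []               = [] , [] , refl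
zipWith-combine-surjective {m} {n} (e ∷ w)
  with i , j , refl ← combine-surjective {m} {n} e
  with x , y , refl ← zipWith-combine-surjective {m} {n} w
  = i ∷ x , j ∷ y , refl

isColumnSet-zipWith-combine : ∀ {n₁ n₂ d} (a : Vec (Fin n₁) d) (t : Vec (Fin n₂) d) →
  IsColumnSet a → IsColumnSet (zipWith combine a t)
isColumnSet-zipWith-combine []          []           _           = []
isColumnSet-zipWith-combine (_ ∷ [])    (_ ∷ [])     _           = [-]
isColumnSet-zipWith-combine (_ ∷ x ∷ a) (y ∷ y′ ∷ t) (x<x′ ∷ a↑) =
  combine-monoˡ-< y y′ x<x′ ∷ isColumnSet-zipWith-combine (x ∷ a) (y′ ∷ t) a↑

entry : ∀ {v k n} → Matrix v k n → Fin k → Fin n → Fin v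
entry M r c = lookup (lookup M r) c

tabulateMatrix : ∀ {v k n} → (Fin k → Fin n → Fin v) → Matrix v k n
tabulateMatrix g = tabulate (tabulate ∘ g)

entry-tabulateMatrix : ∀ {v k n} (g : Fin k → Fin n → Fin v) r c → entry (tabulateMatrix g) r c ≡ g r c
entry-tabulateMatrix g r c =
  trans (cong (λ row → lookup row c) (lookup∘tabulate (tabulate ∘ g) r)) (lookup∘tabulate (g r) c)

productEntry : ∀ {v₁ v₂ k₁ k₂ n₁ n₂} → Matrix v₁ k₁ n₁ → Matrix v₂ k₂ n₂ →
  Fin k₁ × Fin k₂ → Fin n₁ × Fin n₂ → Fin (v₁ * v₂)
productEntry M₁ M₂ (r₁ , r₂) (c₁ , c₂) = combine (entry M₁ r₁ c₁) (entry M₂ r₂ c₂)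

_⊗_ : ∀ {v₁ v₂ k₁ k₂ n₁ n₂} → Matrix v₁ k₁ n₁ → Matrix v₂ k₂ n₂ → Matrix (v₁ * v₂) (k₁ * k₂) (n₁ * n₂)
_⊗_ {k₁ = k₁} {k₂} {n₁} {n₂} M₁ M₂ =
  tabulateMatrix λ r c → productEntry M₁ M₂ (remQuot {k₁} k₂ r) (remQuot {n₁} n₂ c)

module _ {v₁ v₂ k₁ k₂ n₁ n₂} (M₁ : Matrix v₁ k₁ n₁) (M₂ : Matrix v₂ k₂ n₂) where

  entry-⊗ : ∀ r₁ r₂ c₁ c₂ →
    entry (M₁ ⊗ M₂) (combine r₁ r₂) (combine c₁ c₂) ≡ productEntry M₁ M₂ (r₁ , r₂) (c₁ , c₂)
  entry-⊗ r₁ r₂ c₁ c₂ = trans (entry-tabulateMatrix _ (combine r₁ r₂) (combine c₁ c₂))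
    (cong₂ (productEntry M₁ M₂) (remQuot-combine r₁ r₂) (remQuot-combine c₁ c₂))

  subRow-⊗ : ∀ {d} (a : Vec (Fin n₁) d) (t : Vec (Fin n₂) d) r₁ r₂ →
    subRow (M₁ ⊗ M₂) (zipWith combine a t) (combine r₁ r₂) ≡
    zipWith combine (subRow M₁ a r₁) (subRow M₂ t r₂)
  subRow-⊗ []       []       r₁ r₂ = refl
  subRow-⊗ (c₁ ∷ a) (c₂ ∷ t) r₁ r₂ = cong₂ _∷_ (entry-⊗ r₁ r₂ c₁ c₂) (subRow-⊗ a t r₁ r₂)

  shattered-⊗ : ∀ {d} {a : Vec (Fin n₁) d} {t : Vec (Fin n₂) d} →
    Shattered M₁ a → Shattered M₂ t → Shattered (M₁ ⊗ M₂) (zipWith combine a t)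
  shattered-⊗ {a = a} {t} a-shattered t-shattered w
    with x , y , refl ← zipWith-combine-surjective {v₁} {v₂} w
    with r₁ , refl ← a-shattered x
    with r₂ , refl ← t-shattered y
    = combine r₁ r₂ , subRow-⊗ a t r₁ r₂

-- Shattered column sets of the product

ShatteredSet : ∀ {v k n d} → Matrix v k n → Vec (Fin n) d → Set
ShatteredSet M cols = IsColumnSet cols × Shattered M cols

shatteredSet? : ∀ {v k n d} (M : Matrix v k n) → Decidable (ShatteredSet {d = d} M)
shatteredSet? M cols = columnSet? cols ×-dec shattered? M cols

shatteredSets : ∀ {v k n} → Matrix v k n → ∀ d → List (Vec (Fin n) d)
shatteredSets {n = n} M d = filter (shatteredSet? M) (allVecs n d)

length-shatteredSets : ∀ {v k n} (M : Matrix v k n) d → length (shatteredSets M d) ≡ numShattered M d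
length-shatteredSets M d = sym (countVec≡length-filter d (shatteredSet? M))

shatteredSets-unique : ∀ {v k n} (M : Matrix v k n) d → Unique (shatteredSets M d)
shatteredSets-unique {n = n} M d = filter⁺ (shatteredSet? M) (allVecs-unique n d)

∈-shatteredSets⁻ : ∀ {v k n d} (M : Matrix v k n) {cols} → cols ∈ shatteredSets M d → ShatteredSet M cols
∈-shatteredSets⁻ {n = n} {d} M cols∈ = proj₂ (∈-filter⁻ (shatteredSet? M) {xs = allVecs n d} cols∈)

length≤numShattered : ∀ {v k n d} (M : Matrix v k n) {cs : List (Vec (Fin n) d)} →
  Unique cs → All (ShatteredSet M) cs → length cs ≤ numShattered M d
length≤numShattered {d = d} M = length≤countVec d (shatteredSet? M)

shatteredArrangements : ∀ {v k n} → Matrix v k n → ∀ d → List (Vec (Fin n) d)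
shatteredArrangements M d = map (uncurry rearrange) (cartesianProduct (permutations d) (shatteredSets M d))

module _ {v k n} (M : Matrix v k n) (d : ℕ) where

  length-shatteredArrangements : length (shatteredArrangements M d) ≡ d ! * numShattered M d
  length-shatteredArrangements = begin
    length (shatteredArrangements M d)
      ≡⟨ length-map (uncurry rearrange) (cartesianProduct (permutations d) (shatteredSets M d)) ⟩
    length (cartesianProduct (permutations d) (shatteredSets M d))
      ≡⟨ length-cartesianProductWith _,_ (permutations d) (shatteredSets M d) ⟩
    length (permutations d) * length (shatteredSets M d)
      ≡⟨ cong₂ _*_ (length-permutations d) (length-shatteredSets M d) ⟩
    d ! * numShattered M d ∎
    where open ≡-Reasoning

  private
    ∈-permutations×shatteredSets⁻ : ∀ {σ cols} →
      (σ , cols) ∈ cartesianProduct (permutations d) (shatteredSets M d) →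
      IsPermutation σ × ShatteredSet M cols
    ∈-permutations×shatteredSets⁻ σcols∈ =
      let σ∈ , cols∈ = ∈-cartesianProduct⁻ (permutations d) (shatteredSets M d) σcols∈
      in  ∈-permutations⇒isPermutation d σ∈ , ∈-shatteredSets⁻ M cols∈

  shatteredArrangements-unique : Unique (shatteredArrangements M d)
  shatteredArrangements-unique =
    map⁺-injectiveOn (uncurry rearrange) uncurry-rearrange-injectiveOn
      (cartesianProduct⁺ (permutations-unique d) (shatteredSets-unique M d))
    where
    uncurry-rearrange-injectiveOn : ∀ {x y} → x ∈ _ → y ∈ _ →
      uncurry rearrange x ≡ uncurry rearrange y → x ≡ y
    uncurry-rearrange-injectiveOn x∈ y∈ eq
      with σ-perm , cols↑ , _ ← ∈-permutations×shatteredSets⁻ x∈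
      with σ′-perm , cols′↑ , _ ← ∈-permutations×shatteredSets⁻ y∈
      with refl , refl ← rearrange-injectiveOn σ-perm σ′-perm cols↑ cols′↑ eq
      = refl

  ∈-shatteredArrangements⁻ : ∀ {t} → t ∈ shatteredArrangements M d → Shattered M t
  ∈-shatteredArrangements⁻ t∈
    with (σ , cols) , σcols∈ , refl ← ∈-map⁻ (uncurry rearrange) t∈
    with σ-perm , _ , cols-shattered ← ∈-permutations×shatteredSets⁻ σcols∈
    = shattered-rearrange M σ-perm cols-shattered

module _ {v₁ v₂ k₁ k₂ n₁ n₂} (M₁ : Matrix v₁ k₁ n₁) (M₂ : Matrix v₂ k₂ n₂) (d : ℕ) where

  productSets : List (Vec (Fin (n₁ * n₂)) d)
  productSets = cartesianProductWith (zipWith combine) (shatteredSets M₁ d) (shatteredArrangements M₂ d)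

  productSets-unique : Unique productSets
  productSets-unique = cartesianProductWith⁺ (zipWith combine) zipWith-combine-injective
    (shatteredSets-unique M₁ d) (shatteredArrangements-unique M₂ d)

  ∈-productSets⁻ : ∀ {cols} → cols ∈ productSets → ShatteredSet (M₁ ⊗ M₂) cols
  ∈-productSets⁻ cols∈
    with a , t , a∈ , t∈ , refl ← ∈-cartesianProductWith⁻ (zipWith combine) (shatteredSets M₁ d) _ cols∈
    with a↑ , a-shattered ← ∈-shatteredSets⁻ M₁ a∈
    = isColumnSet-zipWith-combine a t a↑ , shattered-⊗ M₁ M₂ a-shattered (∈-shatteredArrangements⁻ M₂ d t∈)

  numShattered-⊗ : d ! * numShattered M₁ d * numShattered M₂ d ≤ numShattered (M₁ ⊗ M₂) d
  numShattered-⊗ = begin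
    d ! * numShattered M₁ d * numShattered M₂ d
      ≡⟨ cong (_* numShattered M₂ d) (*-comm (d !) (numShattered M₁ d)) ⟩
    numShattered M₁ d * d ! * numShattered M₂ d
      ≡⟨ *-assoc (numShattered M₁ d) (d !) (numShattered M₂ d) ⟩
    numShattered M₁ d * (d ! * numShattered M₂ d)
      ≡⟨ cong₂ _*_ (length-shatteredSets M₁ d) (length-shatteredArrangements M₂ d) ⟨
    length (shatteredSets M₁ d) * length (shatteredArrangements M₂ d)
      ≡⟨ length-cartesianProductWith (zipWith combine) (shatteredSets M₁ d) (shatteredArrangements M₂ d) ⟨
    length productSets
      ≤⟨ length≤numShattered (M₁ ⊗ M₂) productSets-unique (All.tabulate ∈-productSets⁻) ⟩
    numShattered (M₁ ⊗ M₂) d ∎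
    where open ≤-Reasoning

f-attained : ∀ {v} → NonZero v → ∀ n k d → Σ[ M ∈ Matrix v k n ] f v n k d ≤ numShattered M d
f-attained {suc _} _ n k d = maxMatrix-attained k n (λ M → numShattered M d)

numShattered≤f : ∀ {v k n} (M : Matrix v k n) d → numShattered M d ≤ f v n k d
numShattered≤f {k = k} {n} M d = ≤-maxMatrix k n (λ M → numShattered M d) M

proposition6p1 : (v₁ v₂ n₁ n₂ k₁ k₂ d : ℕ) →
    NonZero v₁ → NonZero v₂ → NonZero n₁ → NonZero n₂ →
    NonZero k₁ → NonZero k₂ → NonZero d →
    (d !) * f v₁ n₁ k₁ d * f v₂ n₂ k₂ d ≤ f (v₁ * v₂) (n₁ * n₂) (k₁ * k₂) d
proposition6p1 v₁ v₂ n₁ n₂ k₁ k₂ d v₁≢0 v₂≢0 _ _ _ _ _ =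
  let M₁ , f₁≤ = f-attained v₁≢0 n₁ k₁ d
      M₂ , f₂≤ = f-attained v₂≢0 n₂ k₂ d
  in  begin
    d ! * f v₁ n₁ k₁ d * f v₂ n₂ k₂ d            ≤⟨ *-mono-≤ (*-monoʳ-≤ (d !) f₁≤) f₂≤ ⟩
    d ! * numShattered M₁ d * numShattered M₂ d  ≤⟨ numShattered-⊗ M₁ M₂ d ⟩
    numShattered (M₁ ⊗ M₂) d                     ≤⟨ numShattered≤f (M₁ ⊗ M₂) d ⟩
    f (v₁ * v₂) (n₁ * n₂) (k₁ * k₂) d            ∎
  where open ≤-Reasoning
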